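{- Let $n\ge 1$ and $m\ge 2$ be integers, let $G$ be a finite region-connected $n$-simplex graph with chromatic number $\chi(G)=n+1$, and let $c:V(G)\to\{0,1,\dots,n\}$ be a proper vertex coloring of $G$. Then for every labeling $L:V(G)\to\mathbb{Z}_m$ and every $n$-simplex $S$ of $G$, we have $P_c[f_S(L)]=P_c[L]$, i.e. $P_c$ is invariant under pushes.
   Context: All graphs are finite simple graphs. An $n$-simplex of a graph $G$ is a set of $n+1$ vertices of $G$ that are pairwise adjacent. $G$ is an $n$-simplex graph if $G$ is a union of complete subgraphs on $n+1$ vertices (every vertex and every edge of $G$ lies in some $n$-simplex of $G$). Two $n$-simplexes $S,S'$ are adjacent if $|S\cap S'|=n$; $G$ is region-connected if for any two $n$-simplexes $S,S'$ there is a sequence $S=S_1,S_2,\dots,S_t=S'$ of $n$-simplexes with $S_j$ adjacent to $S_{j+1}$ for all $j$. A labeling is a map $L:V(G)\to\mathbb{Z}_m$. For an $n$-simplex $S$, the push $f_S$ sends a labeling $L$ to the labeling $L'$ with $L'(v)=L(v)+1 \pmod m$ for $v\in S$ and $L'(v)=L(v)$ for $v\notin S$. Let $\zeta=e^{2\pi i/m}$. For $0\le k<n$ let $i_k$ be the $n\times n$ complex diagonal matrix with $\zeta$ in diagonal position $k+1$ and $1$ in all other diagonal positions, and let $i_n=\zeta^{m-1}I_n$. For a proper coloring $c:V(G)\to\{0,\dots,n\}$ and a labeling $L$, define $P_c[L]=\prod_{v\in V(G)} i_{c(v)}^{\,L(v)}$ (well defined since these matrices commute and satisfy $i_k^m=I_n$).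 -}

module Defs where

open import Data.Nat using (ℕ; zero; suc; _+_; _∸_; _≤_; NonZero; _≡ᵇ_)
open import Data.Nat.DivMod using (_mod_)
open import Data.Fin using (Fin; toℕ)
open import Data.Fin.Subset using (Subset; _∈_; _∩_; ∣_∣)
open import Data.Vec using (Vec; tabulate; zipWith; replicate; lookup)
open import Data.List using (List; foldr; allFin)
open import Data.Bool using (if_then_else_)
open import Data.Product using (Σ; ∃; _×_; proj₁)
open import Relation.Nullary using (¬_)
open import Relation.Binary.PropositionalEquality using (_≡_; _≢_)
open import Relation.Binary.Construct.Closure.ReflexiveTransitive using (Star)

record Graph : Set₁ where
  field
    N          : ℕ
    Adj        : Fin N → Fin N → Set
    adj-sym    : ∀ {u v} → Adj u v → Adj v u
    adj-irrefl : ∀ {v} → ¬ Adj v v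
open Graph public

module _ (G : Graph) where

  Proper : ∀ {k} → (Fin (N G) → Fin k) → Set
  Proper c = ∀ u v → Adj G u v → c u ≢ c v

  ChromaticNumber : ℕ → Set
  ChromaticNumber k =
    Σ (Fin (N G) → Fin k) Proper × (∀ k' (c : Fin (N G) → Fin k') → Proper c → k ≤ k')

  module _ (n : ℕ) where
    IsSimplex : Subset (N G) → Set
    IsSimplex S = ∣ S ∣ ≡ suc n × (∀ u v → u ∈ S → v ∈ S → u ≢ v → Adj G u v)

    Simplex : Set
    Simplex = Σ (Subset (N G)) IsSimplex

    IsSimplexGraph : Set
    IsSimplexGraph =
      (∀ v → ∃ λ S → IsSimplex S × v ∈ S) ×
      (∀ u v → Adj G u v → ∃ λ S → IsSimplex S × u ∈ S × v ∈ S)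

    AdjSimplex : Simplex → Simplex → Set
    AdjSimplex S S' = ∣ proj₁ S ∩ proj₁ S' ∣ ≡ n

    RegionConnected : Set
    RegionConnected = ∀ (S S' : Simplex) → Star AdjSimplex S S'

module _ (m : ℕ) .{{_ : NonZero m}} where

  Zm : Set
  Zm = Fin m

  _+ₘ_ : Zm → Zm → Zm
  a +ₘ b = (toℕ a + toℕ b) mod m

  ⟦_⟧ₘ : ℕ → Zm
  ⟦ k ⟧ₘ = k mod m

Labeling : (G : Graph) (m : ℕ) → Set
Labeling G m = Fin (N G) → Fin m

push : (G : Graph) (m : ℕ) .{{_ : NonZero m}} → Subset (N G) → Labeling G m → Labeling G m
push G m S L v = if lookup S v then _+ₘ_ m (L v) (⟦_⟧ₘ m 1) else L v

-- n×n diagonal matrices whose diagonal entries are m-th roots of unity.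
-- Since ζ = e^{2πi/m} is a primitive m-th root of unity, a ↦ ζ^a is an
-- isomorphism ℤ_m ≅ μ_m; such a matrix diag(ζ^{a₀},…,ζ^{a_{n-1}}) is
-- represented by its exponent vector (a₀,…,a_{n-1}) ∈ ℤ_mⁿ, and matrix
-- multiplication becomes componentwise addition in ℤ_m.

module _ (m : ℕ) .{{_ : NonZero m}} (n : ℕ) where

  DiagRoot : Set
  DiagRoot = Vec (Zm m) n

  Iₙ : DiagRoot
  Iₙ = replicate n (⟦_⟧ₘ m 0)

  _·_ : DiagRoot → DiagRoot → DiagRoot
  A · B = zipWith (_+ₘ_ m) A B

  pow : DiagRoot → ℕ → DiagRoot
  pow A zero    = Iₙ
  pow A (suc e) = A · pow A e

  -- i_k : for k < n, ζ at (0-based) diagonal position k and 1 elsewhere;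
  --        i_n = ζ^{m-1} I_n
  gen : Fin (suc n) → DiagRoot
  gen k = tabulate λ j →
    if toℕ k ≡ᵇ n then ⟦_⟧ₘ m (m ∸ 1)
    else (if toℕ j ≡ᵇ toℕ k then ⟦_⟧ₘ m 1 else ⟦_⟧ₘ m 0)

P : (G : Graph) (m : ℕ) .{{_ : NonZero m}} (n : ℕ) →
    (Fin (N G) → Fin (suc n)) → Labeling G m → DiagRoot m n
P G m n c L =
  foldr (λ v acc → _·_ m n (pow m n (gen m n (c v)) (toℕ (L v))) acc)
        (Iₙ m n) (allFin (N G))

-- In diagonal position j, P_c[L] is ζ raised to Σ_v L(v)·e(c(v), j), where e(k, j) is the
-- exponent of ζ at position j of i_k. Pushing a simplex S adds Σ_{v∈S} e(c(v), j) to this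
-- exponent. A proper colouring is injective on S; as S has n+1 vertices and there are n+1
-- colours, c takes every colour exactly once on S, so the increment is
-- Σ_k e(k, j) = 1 + (m − 1) = m ≡ 0 (mod m).
{-# OPTIONS --safe #-}
module Submission where

open import Defs
open import Data.Nat using (ℕ; zero; suc; _+_; _*_; _∸_; _%_; _≡ᵇ_; _≤_; z≤n; pred; NonZero)
open import Data.Nat.Properties
  using (+-*-semiring; ≤-reflexive; ≤-antisym; +-monoʳ-≤; +-mono-≤; +-cancelʳ-≤; +-identityʳ;
         *-identityˡ; *-identityʳ; *-distribʳ-+; suc-injective; _≟_; suc-pred; ≡ᵇ⇒≡)
open import Data.Nat.DivMod
  using (_mod_; m%n<n; m<n⇒m%n≡m; m%n%n≡m%n; %-distribˡ-+; %-distribˡ-*; [m+n]%n≡m%n)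
open import Data.Fin using (Fin; zero; suc; toℕ; inject₁; fromℕ)
open import Data.Fin.Properties
  using (toℕ-injective; toℕ<n; toℕ-fromℕ<; fromℕ<-cong; fromℕ<-toℕ; toℕ-inject₁; toℕ-inject₁-≢; toℕ-fromℕ)
import Data.Fin.Properties as Fin
open import Data.Fin.Subset using (Subset; _∈_; ∣_∣)
open import Data.Vec using (Vec; []; _∷_; lookup)
open import Data.Vec.Properties
  using (lookup-zipWith; lookup-replicate; lookup∘tabulate; tabulate∘lookup; tabulate-cong; lookup⇒[]=)
import Data.List as List
open import Data.Bool using (Bool; true; false; T; _∧_; if_then_else_)
open import Data.Bool.Properties using (T-∧; T-≡; if-float)
open import Data.Product using (_,_; _×_; proj₁)
open import Data.Empty using (⊥-elim)
open import Function using (_∘_; Equivalence)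
open import Relation.Nullary using (¬_)
open import Relation.Nullary.Decidable using (decidable-stable; dec-true; dec-false)
open import Relation.Binary.PropositionalEquality using (_≡_; refl; sym; trans; cong; cong₂; subst; module ≡-Reasoning)
open import Algebra.Properties.Semiring.Sum +-*-semiring
  using (sum-syntax; sum-cong-≗; sum-replicate-zero; sum-init-last; ∑-distrib-+; ∑-comm; *-distribˡ-sum; *-distribʳ-sum)

open ≡-Reasoning

lookup-extensionality : ∀ {A : Set} {k} {x y : Vec A k} → (∀ j → lookup x j ≡ lookup y j) → x ≡ y
lookup-extensionality {x = x} {y} x≗y = trans (sym (tabulate∘lookup x)) (trans (tabulate-cong x≗y) (tabulate∘lookup y))

𝟙 : Bool → ℕ
𝟙 b = if b then 1 else 0

𝟙-∧-* : ∀ a b x → 𝟙 a * (𝟙 b * x) ≡ 𝟙 (a ∧ b) * x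
𝟙-∧-* true  b x = *-identityˡ (𝟙 b * x)
𝟙-∧-* false b x = refl

∑-𝟙≡0 : ∀ {N} (b : Fin N → Bool) → (∀ v → ¬ T (b v)) → ∑[ v < N ] 𝟙 (b v) ≡ 0
∑-𝟙≡0 {N} b none = trans (sum-cong-≗ (λ v → 𝟙-false (b v) (none v))) (sum-replicate-zero N)
  where
  𝟙-false : ∀ x → ¬ T x → 𝟙 x ≡ 0
  𝟙-false true  ¬t = ⊥-elim (¬t _)
  𝟙-false false ¬t = refl

∑-𝟙≤1 : ∀ {N} (b : Fin N → Bool) → (∀ u v → T (b u) → T (b v) → u ≡ v) → ∑[ v < N ] 𝟙 (b v) ≤ 1
∑-𝟙≤1 {zero}  b unique = z≤n
∑-𝟙≤1 {suc N} b unique with b zero in b₀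
... | true  = ≤-reflexive (cong suc (∑-𝟙≡0 (b ∘ suc) λ v t → Fin.0≢1+n (unique zero (suc v) b₀-holds t)))
  where
  b₀-holds : T (b zero)
  b₀-holds = Equivalence.from T-≡ b₀
... | false = ∑-𝟙≤1 (b ∘ suc) (λ u v tu tv → Fin.suc-injective (unique (suc u) (suc v) tu tv))

∑-≤1⇒≤n : ∀ {n} (f : Fin n → ℕ) → (∀ i → f i ≤ 1) → ∑[ i < n ] f i ≤ n
∑-≤1⇒≤n {zero}  f f≤1 = z≤n
∑-≤1⇒≤n {suc n} f f≤1 = +-mono-≤ (f≤1 zero) (∑-≤1⇒≤n (f ∘ suc) (f≤1 ∘ suc))

∑≡n⇒≡1 : ∀ {n} (f : Fin n → ℕ) → (∀ i → f i ≤ 1) → ∑[ i < n ] f i ≡ n → ∀ i → f i ≡ 1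
∑≡n⇒≡1 {suc n} f f≤1 ∑f≡1+n zero = ≤-antisym (f≤1 zero) (+-cancelʳ-≤ n 1 (f zero)
  (subst (_≤ f zero + n) ∑f≡1+n (+-monoʳ-≤ (f zero) (∑-≤1⇒≤n (f ∘ suc) (f≤1 ∘ suc)))))
∑≡n⇒≡1 {suc n} f f≤1 ∑f≡1+n (suc i) =
  ∑≡n⇒≡1 (f ∘ suc) (f≤1 ∘ suc) (suc-injective (trans (cong (_+ ∑[ i < n ] f (suc i)) (sym f₀≡1)) ∑f≡1+n)) i
  where
  f₀≡1 : f zero ≡ 1
  f₀≡1 = ∑≡n⇒≡1 f f≤1 ∑f≡1+n zero

∑-select : ∀ {K} (x : Fin K) (h : Fin K → ℕ) → ∑[ k < K ] (𝟙 (toℕ x ≡ᵇ toℕ k) * h k) ≡ h x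
∑-select {suc K} zero    h = begin
  1 * h zero + ∑[ k < K ] 0 ≡⟨ cong₂ _+_ (*-identityˡ (h zero)) (sum-replicate-zero K) ⟩
  h zero + 0                ≡⟨ +-identityʳ (h zero) ⟩
  h zero                    ∎
∑-select {suc K} (suc x) h = ∑-select x (h ∘ suc)

∣∣≡∑𝟙 : ∀ {N} (S : Subset N) → ∣ S ∣ ≡ ∑[ v < N ] 𝟙 (lookup S v)
∣∣≡∑𝟙 []          = refl
∣∣≡∑𝟙 (true  ∷ S) = cong suc (∣∣≡∑𝟙 S)
∣∣≡∑𝟙 (false ∷ S) = ∣∣≡∑𝟙 S

InjectiveOn : ∀ {N} {A : Set} → Subset N → (Fin N → A) → Set
InjectiveOn S c = ∀ u v → u ∈ S → v ∈ S → c u ≡ c v → u ≡ v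

module _ {N K : ℕ} (S : Subset N) (c : Fin N → Fin K) where

  colourCount : Fin K → ℕ
  colourCount k = ∑[ v < N ] 𝟙 (lookup S v ∧ (toℕ (c v) ≡ᵇ toℕ k))

  ∑-fibres : (h : Fin K → ℕ) → ∑[ v < N ] (𝟙 (lookup S v) * h (c v)) ≡ ∑[ k < K ] (colourCount k * h k)
  ∑-fibres h = begin
    ∑[ v < N ] (𝟙 (lookup S v) * h (c v))
      ≡⟨ sum-cong-≗ (λ v → cong (𝟙 (lookup S v) *_) (sym (∑-select (c v) h))) ⟩
    ∑[ v < N ] (𝟙 (lookup S v) * ∑[ k < K ] (𝟙 (toℕ (c v) ≡ᵇ toℕ k) * h k))
      ≡⟨ sum-cong-≗ (λ v → trans (*-distribˡ-sum {K} (𝟙 (lookup S v)) _)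
                               (sum-cong-≗ {K} λ k → 𝟙-∧-* (lookup S v) (toℕ (c v) ≡ᵇ toℕ k) (h k))) ⟩
    ∑[ v < N ] ∑[ k < K ] (𝟙 (lookup S v ∧ (toℕ (c v) ≡ᵇ toℕ k)) * h k)
      ≡⟨ ∑-comm {N} {K} _ ⟩
    ∑[ k < K ] ∑[ v < N ] (𝟙 (lookup S v ∧ (toℕ (c v) ≡ᵇ toℕ k)) * h k)
      ≡⟨ sum-cong-≗ (λ k → sym (*-distribʳ-sum {N} (h k) _)) ⟩
    ∑[ k < K ] (colourCount k * h k)
      ∎

  ∑-colourCount : ∑[ k < K ] colourCount k ≡ ∣ S ∣
  ∑-colourCount = begin
    ∑[ k < K ] colourCount k         ≡⟨ sum-cong-≗ (sym ∘ *-identityʳ ∘ colourCount) ⟩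
    ∑[ k < K ] (colourCount k * 1)   ≡⟨ sym (∑-fibres λ _ → 1) ⟩
    ∑[ v < N ] (𝟙 (lookup S v) * 1)  ≡⟨ sum-cong-≗ (*-identityʳ ∘ 𝟙 ∘ lookup S) ⟩
    ∑[ v < N ] 𝟙 (lookup S v)        ≡⟨ sym (∣∣≡∑𝟙 S) ⟩
    ∣ S ∣                            ∎

  colourCount≤1 : InjectiveOn S c → ∀ k → colourCount k ≤ 1
  colourCount≤1 injective k = ∑-𝟙≤1 _ λ u v tu tv →
    let u∈S , cu≡k = in-class u tu ; v∈S , cv≡k = in-class v tv
    in injective u v u∈S v∈S (trans cu≡k (sym cv≡k))
    where
    in-class : ∀ v → T (lookup S v ∧ (toℕ (c v) ≡ᵇ toℕ k)) → v ∈ S × c v ≡ k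
    in-class v t =
      let v∈S , cv≡k = Equivalence.to T-∧ t
      in lookup⇒[]= v S (Equivalence.to T-≡ v∈S) , toℕ-injective (≡ᵇ⇒≡ _ _ cv≡k)

  ∑-reindex-injectiveOn : InjectiveOn S c → ∣ S ∣ ≡ K → (h : Fin K → ℕ) →
                          ∑[ v < N ] (𝟙 (lookup S v) * h (c v)) ≡ ∑[ k < K ] h k
  ∑-reindex-injectiveOn injective ∣S∣≡K h = begin
    ∑[ v < N ] (𝟙 (lookup S v) * h (c v)) ≡⟨ ∑-fibres h ⟩
    ∑[ k < K ] (colourCount k * h k)      ≡⟨ sum-cong-≗ (λ k → cong (_* h k) (colourCount≡1 k)) ⟩
    ∑[ k < K ] (1 * h k)                  ≡⟨ sum-cong-≗ (*-identityˡ ∘ h) ⟩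
    ∑[ k < K ] h k                        ∎
    where
    colourCount≡1 : ∀ k → colourCount k ≡ 1
    colourCount≡1 = ∑≡n⇒≡1 colourCount (colourCount≤1 injective) (trans ∑-colourCount ∣S∣≡K)

proper⇒injectiveOn-simplex : ∀ {G n k} {c : Fin (N G) → Fin k} {S : Subset (N G)} →
                             Proper G c → IsSimplex G n S → InjectiveOn S c
proper⇒injectiveOn-simplex proper (_ , clique) u v u∈S v∈S cu≡cv =
  decidable-stable (u Fin.≟ v) λ u≢v → proper u v (clique u v u∈S v∈S u≢v) cu≡cv

module _ (m : ℕ) .{{_ : NonZero m}} where

  %⇒mod : ∀ {a b} → a % m ≡ b % m → a mod m ≡ b mod m
  %⇒mod {a} {b} eq = fromℕ<-cong (a % m) (b % m) eq (m%n<n a m) (m%n<n b m)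

  mod-toℕ : (x : Fin m) → toℕ x mod m ≡ x
  mod-toℕ x = trans (fromℕ<-cong _ _ (m<n⇒m%n≡m (toℕ<n x)) _ (toℕ<n x)) (fromℕ<-toℕ x (toℕ<n x))

  mod-+ : ∀ a b → _+ₘ_ m (a mod m) (b mod m) ≡ (a + b) mod m
  mod-+ a b = %⇒mod (begin
    (toℕ (a mod m) + toℕ (b mod m)) % m ≡⟨ cong₂ (λ x y → (x + y) % m) (toℕ-fromℕ< (m%n<n a m)) (toℕ-fromℕ< (m%n<n b m)) ⟩
    (a % m + b % m) % m                 ≡⟨ sym (%-distribˡ-+ a b m) ⟩
    (a + b) % m                         ∎)

  mod-toℕ-* : ∀ a b → toℕ (a mod m) * b mod m ≡ a * b mod m
  mod-toℕ-* a b = %⇒mod (begin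
    (toℕ (a mod m) * b) % m       ≡⟨ cong (λ x → (x * b) % m) (toℕ-fromℕ< (m%n<n a m)) ⟩
    (a % m * b) % m               ≡⟨ %-distribˡ-* (a % m) b m ⟩
    (a % m % m * (b % m)) % m     ≡⟨ cong (λ x → (x * (b % m)) % m) (m%n%n≡m%n a m) ⟩
    (a % m * (b % m)) % m         ≡⟨ sym (%-distribˡ-* a b m) ⟩
    (a * b) % m                   ∎)

  mod-+-period : ∀ a → (a + m) mod m ≡ a mod m
  mod-+-period a = %⇒mod ([m+n]%n≡m%n a m)

  ∑-mod-cong : ∀ {K} (f g : Fin K → ℕ) → (∀ i → f i mod m ≡ g i mod m) →
               ∑[ i < K ] f i mod m ≡ ∑[ i < K ] g i mod m
  ∑-mod-cong {zero}  f g f≡g = refl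
  ∑-mod-cong {suc K} f g f≡g = begin
    (f zero + ∑[ i < K ] f (suc i)) mod m                     ≡⟨ sym (mod-+ _ _) ⟩
    _+ₘ_ m (f zero mod m) (∑[ i < K ] f (suc i) mod m)
      ≡⟨ cong₂ (_+ₘ_ m) (f≡g zero) (∑-mod-cong (f ∘ suc) (g ∘ suc) (f≡g ∘ suc)) ⟩
    _+ₘ_ m (g zero mod m) (∑[ i < K ] g (suc i) mod m)        ≡⟨ mod-+ _ _ ⟩
    (g zero + ∑[ i < K ] g (suc i)) mod m                     ∎

  module _ (n : ℕ) where

    exponent : Fin (suc n) → Fin n → ℕ
    exponent k j = if toℕ k ≡ᵇ n then m ∸ 1 else 𝟙 (toℕ j ≡ᵇ toℕ k)

    lookup-gen : ∀ k j → lookup (gen m n k) j ≡ exponent k j mod m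
    lookup-gen k j = begin
      lookup (gen m n k) j ≡⟨ lookup∘tabulate _ j ⟩
      (if toℕ k ≡ᵇ n then (m ∸ 1) mod m else (if toℕ j ≡ᵇ toℕ k then 1 mod m else 0 mod m))
        ≡⟨ cong (if toℕ k ≡ᵇ n then (m ∸ 1) mod m else_) (sym (if-float (_mod m) (toℕ j ≡ᵇ toℕ k))) ⟩
      (if toℕ k ≡ᵇ n then (m ∸ 1) mod m else 𝟙 (toℕ j ≡ᵇ toℕ k) mod m)
        ≡⟨ sym (if-float (_mod m) (toℕ k ≡ᵇ n)) ⟩
      exponent k j mod m ∎

    ∑-exponent : ∀ j → ∑[ k < suc n ] exponent k j ≡ m
    ∑-exponent j = begin
      ∑[ k < suc n ] exponent k j                               ≡⟨ sum-init-last (λ k → exponent k j) ⟩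
      ∑[ k < n ] exponent (inject₁ k) j + exponent (fromℕ n) j  ≡⟨ cong₂ _+_ (sum-cong-≗ exponent-inject₁) exponent-fromℕ ⟩
      ∑[ k < n ] 𝟙 (toℕ j ≡ᵇ toℕ k) + (m ∸ 1)                   ≡⟨ cong (_+ (m ∸ 1)) ∑-𝟙≡1 ⟩
      suc (pred m)                                              ≡⟨ suc-pred m ⟩
      m                                                         ∎
      where
      exponent-inject₁ : ∀ k → exponent (inject₁ k) j ≡ 𝟙 (toℕ j ≡ᵇ toℕ k)
      exponent-inject₁ k
        rewrite dec-false (toℕ (inject₁ k) ≟ n) (toℕ-inject₁-≢ k ∘ sym)
              | toℕ-inject₁ k = refl
      exponent-fromℕ : exponent (fromℕ n) j ≡ m ∸ 1
      exponent-fromℕ rewrite dec-true (toℕ (fromℕ n) ≟ n) (toℕ-fromℕ n) = refl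
      ∑-𝟙≡1 : ∑[ k < n ] 𝟙 (toℕ j ≡ᵇ toℕ k) ≡ 1
      ∑-𝟙≡1 = trans (sum-cong-≗ {n} (λ k → sym (*-identityʳ (𝟙 (toℕ j ≡ᵇ toℕ k))))) (∑-select j λ _ → 1)

    lookup-pow : ∀ (A : DiagRoot m n) j {a} → lookup A j ≡ a mod m → ∀ e → lookup (pow m n A e) j ≡ e * a mod m
    lookup-pow A j Aⱼ≡a zero    = lookup-replicate j (0 mod m)
    lookup-pow A j Aⱼ≡a (suc e) = begin
      lookup (_·_ m n A (pow m n A e)) j                ≡⟨ lookup-zipWith (_+ₘ_ m) j A (pow m n A e) ⟩
      _+ₘ_ m (lookup A j) (lookup (pow m n A e) j)      ≡⟨ cong₂ (_+ₘ_ m) Aⱼ≡a (lookup-pow A j Aⱼ≡a e) ⟩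
      _+ₘ_ m (_ mod m) (e * _ mod m)                    ≡⟨ mod-+ _ _ ⟩
      suc e * _ mod m                                   ∎

    module _ (G : Graph) (c : Fin (N G) → Fin (suc n)) where

      lookup-P : (L : Labeling G m) (j : Fin n) →
                 lookup (P G m n c L) j ≡ ∑[ v < N G ] (toℕ (L v) * exponent (c v) j) mod m
      lookup-P L j = lookup-foldr (λ v → v)
        where
        factor : Fin (N G) → DiagRoot m n
        factor v = pow m n (gen m n (c v)) (toℕ (L v))
        lookup-foldr : ∀ {K} (f : Fin K → Fin (N G)) →
          lookup (List.foldr (λ v → _·_ m n (factor v)) (Iₙ m n) (List.tabulate f)) j
            ≡ ∑[ i < K ] (toℕ (L (f i)) * exponent (c (f i)) j) mod m
        lookup-foldr {zero}  f = lookup-replicate j (0 mod m)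
        lookup-foldr {suc K} f = begin
          lookup (_·_ m n (factor (f zero)) rest) j                  ≡⟨ lookup-zipWith (_+ₘ_ m) j (factor (f zero)) rest ⟩
          _+ₘ_ m (lookup (factor (f zero)) j) (lookup rest j)
            ≡⟨ cong₂ (_+ₘ_ m) (lookup-pow _ j (lookup-gen (c (f zero)) j) (toℕ (L (f zero)))) (lookup-foldr (f ∘ suc)) ⟩
          _+ₘ_ m (_ mod m) (_ mod m)                                 ≡⟨ mod-+ _ _ ⟩
          _ mod m                                                    ∎
          where
          rest : DiagRoot m n
          rest = List.foldr (λ v → _·_ m n (factor v)) (Iₙ m n) (List.tabulate (f ∘ suc))

      push-lift : (S : Subset (N G)) (L : Labeling G m) →
                  ∀ v → push G m S L v ≡ (toℕ (L v) + 𝟙 (lookup S v)) mod m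
      push-lift S L v = by-membership (lookup S v)
        where
        by-membership : ∀ b → (if b then _+ₘ_ m (L v) (1 mod m) else L v) ≡ (toℕ (L v) + 𝟙 b) mod m
        by-membership true  = trans (cong (λ x → _+ₘ_ m x (1 mod m)) (sym (mod-toℕ (L v)))) (mod-+ _ 1)
        by-membership false = sym (trans (cong (_mod m) (+-identityʳ _)) (mod-toℕ (L v)))

      P-push : Proper G c → (L : Labeling G m) (S : Simplex G n) →
               P G m n c (push G m (proj₁ S) L) ≡ P G m n c L
      P-push proper L (S , simplex) = lookup-extensionality coordinate
        where
        L′ : Labeling G m
        L′ = push G m S L
        coordinate : ∀ j → lookup (P G m n c L′) j ≡ lookup (P G m n c L) j
        coordinate j = begin
          lookup (P G m n c L′) j                                     ≡⟨ lookup-P L′ j ⟩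
          ∑[ v < N G ] (toℕ (L′ v) * e v) mod m                       ≡⟨ ∑-mod-cong _ _ pushed-term ⟩
          ∑[ v < N G ] ((ℓ v + s v) * e v) mod m                      ≡⟨ cong (_mod m) split ⟩
          (∑[ v < N G ] (ℓ v * e v) + ∑[ v < N G ] (s v * e v)) mod m
            ≡⟨ cong (λ t → (∑[ v < N G ] (ℓ v * e v) + t) mod m) increment≡m ⟩
          (∑[ v < N G ] (ℓ v * e v) + m) mod m                        ≡⟨ mod-+-period _ ⟩
          ∑[ v < N G ] (ℓ v * e v) mod m                              ≡⟨ sym (lookup-P L j) ⟩
          lookup (P G m n c L) j                                      ∎
          where
          e ℓ s : Fin (N G) → ℕ
          e v = exponent (c v) j
          ℓ v = toℕ (L v)
          s v = 𝟙 (lookup S v)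
          pushed-term : ∀ v → toℕ (L′ v) * e v mod m ≡ (ℓ v + s v) * e v mod m
          pushed-term v = trans (cong (λ x → toℕ x * e v mod m) (push-lift S L v)) (mod-toℕ-* _ (e v))
          split : ∑[ v < N G ] ((ℓ v + s v) * e v) ≡ ∑[ v < N G ] (ℓ v * e v) + ∑[ v < N G ] (s v * e v)
          split = trans (sum-cong-≗ λ v → *-distribʳ-+ (e v) (ℓ v) (s v)) (∑-distrib-+ (λ v → ℓ v * e v) (λ v → s v * e v))
          increment≡m : ∑[ v < N G ] (s v * e v) ≡ m
          increment≡m = trans
            (∑-reindex-injectiveOn S c (proper⇒injectiveOn-simplex {G} {n} proper simplex) (proj₁ simplex) (λ k → exponent k j))
            (∑-exponent j)

lemma4p4p3 : (n m : ℕ) .{{_ : NonZero m}} → 1 ≤ n → 2 ≤ m →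
    (G : Graph) → IsSimplexGraph G n → RegionConnected G n →
    ChromaticNumber G (suc n) →
    (c : Fin (N G) → Fin (suc n)) → Proper G c →
    (L : Labeling G m) (S : Simplex G n) →
    P G m n c (push G m (proj₁ S) L) ≡ P G m n c L
lemma4p4p3 n m _ _ G _ _ _ c proper = P-push m n G c proper
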